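{- Let $M$ be a computation of $\lambda_{\copyright}$ such that $M\to_{\copyright}^* !W$ for some value $W$. Then $M$ is a $\beta_c$-redex, or a $\sigma$-redex, or has the form $!U$ for some value $U$.
   Context: The computational core $\lambda_{\copyright}$ has values $V,W ::= x \mid \lambda x.M$ and computations $M,N,L ::= \,!V \mid VM$ ($x$ ranging over a countable set of variables, terms up to $\alpha$-renaming). Rules: $\beta_c$: $(\lambda x.M)(!V) \mapsto M\{V/x\}$; $\mathsf{id}$: $(\lambda x.!x)M \mapsto M$; $\sigma$: $(\lambda y.N)((\lambda x.M)L) \mapsto (\lambda x.(\lambda y.N)M)L$ provided $x\notin \mathrm{fv}(N)$; $\copyright=\beta_c\cup\mathsf{id}\cup\sigma$. A $\rho$-redex is a term $R$ such that $R\mapsto_\rho R'$ for some $R'$. Contexts: $C ::= [\,] \mid\, !(\lambda x.C) \mid VC \mid (\lambda x.C)M$; $\to_{\copyright}$ is the closure of $\copyright$ under contexts. -}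

module Defs where

open import Data.Nat using (ℕ; zero; suc)
open import Data.Fin using (Fin; zero; suc)
open import Data.Product using (∃; ∃-syntax; _,_)
open import Data.Sum using (_⊎_)
open import Relation.Binary.PropositionalEquality using (_≡_)
open import Relation.Binary.Construct.Closure.ReflexiveTransitive using (Star)

-- Terms of λ© up to α-renaming, represented by well-scoped de Bruijn
-- indices: Val n / Comp n are terms whose free variables are among n.
mutual
  data Val (n : ℕ) : Set where
    var : Fin n → Val n
    lam : Comp (suc n) → Val n     -- λx.M  (x is index 0 in M)

  data Comp (n : ℕ) : Set where
    ret : Val n → Comp n
    app : Val n → Comp n → Comp n

ext : ∀ {n m} → (Fin n → Fin m) → Fin (suc n) → Fin (suc m)
ext ρ zero    = zero
ext ρ (suc i) = suc (ρ i)

mutual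
  renV : ∀ {n m} → (Fin n → Fin m) → Val n → Val m
  renV ρ (var i) = var (ρ i)
  renV ρ (lam M) = lam (renC (ext ρ) M)

  renC : ∀ {n m} → (Fin n → Fin m) → Comp n → Comp m
  renC ρ (ret V)   = ret (renV ρ V)
  renC ρ (app V M) = app (renV ρ V) (renC ρ M)

exts : ∀ {n m} → (Fin n → Val m) → Fin (suc n) → Val (suc m)
exts σ zero    = var zero
exts σ (suc i) = renV suc (σ i)

mutual
  subV : ∀ {n m} → (Fin n → Val m) → Val n → Val m
  subV σ (var i) = σ i
  subV σ (lam M) = lam (subC (exts σ) M)

  subC : ∀ {n m} → (Fin n → Val m) → Comp n → Comp m
  subC σ (ret V)   = ret (subV σ V)
  subC σ (app V M) = app (subV σ V) (subC σ M)

single : ∀ {n} → Val n → Fin (suc n) → Val n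
single V zero    = V
single V (suc i) = var i

_[_] : ∀ {n} → Comp (suc n) → Val n → Comp n
M [ V ] = subC (single V) M

-- weakening under one binder: inserts a fresh variable at index 1
-- (used for the side condition x ∉ fv(N) in σ: N is placed under the new
-- binder x, which it does not mention)
wk1 : ∀ {n} → Fin (suc n) → Fin (suc (suc n))
wk1 zero    = zero
wk1 (suc i) = suc (suc i)

data _↦βc_ {n : ℕ} : Comp n → Comp n → Set where
  βc : ∀ (M : Comp (suc n)) (V : Val n) → app (lam M) (ret V) ↦βc (M [ V ])

data _↦id_ {n : ℕ} : Comp n → Comp n → Set where
  idr : ∀ (M : Comp n) → app (lam (ret (var zero))) M ↦id M

-- σ: (λy.N)((λx.M)L) ↦ (λx.(λy.N)M)L, x ∉ fv(N)
data _↦σ_ {n : ℕ} : Comp n → Comp n → Set where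
  σr : ∀ (N : Comp (suc n)) (M : Comp (suc n)) (L : Comp n) →
       app (lam N) (app (lam M) L) ↦σ app (lam (app (lam (renC wk1 N)) M)) L

data _↦©_ {n : ℕ} : Comp n → Comp n → Set where
  by-βc : ∀ {M M'} → M ↦βc M' → M ↦© M'
  by-id : ∀ {M M'} → M ↦id M' → M ↦© M'
  by-σ  : ∀ {M M'} → M ↦σ M' → M ↦© M'

βc-redex : ∀ {n} → Comp n → Set
βc-redex M = ∃[ M' ] (M ↦βc M')

σ-redex : ∀ {n} → Comp n → Set
σ-redex M = ∃[ M' ] (M ↦σ M')

data _→©_ : ∀ {n} → Comp n → Comp n → Set where
  root   : ∀ {n} {M M' : Comp n} → M ↦© M' → M →© M'
  ret-lam : ∀ {n} {M M' : Comp (suc n)} → M →© M' → ret (lam M) →© ret (lam M')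
  app-r  : ∀ {n} (V : Val n) {M M' : Comp n} → M →© M' → app V M →© app V M'
  app-lam : ∀ {n} {M M' : Comp (suc n)} (N : Comp n) →
            M →© M' → app (lam M) N →© app (lam M') N

_→©*_ : ∀ {n} → Comp n → Comp n → Set
M →©* N = Star _→©_ M N

-- A computation that is neither !U, nor a βc- nor a σ-redex is of the form
-- (λ.P₁)((λ.P₂)(… (x L))) with k ≥ 0 abstractions above an application of a
-- variable.  This shape is preserved by every →© step (id and σ only remove
-- or reassociate the abstractions, βc never applies, and inner steps keep the
-- head variable), so such a computation never reaches a value !W.
module Submission where

open import Defs
open import Data.Nat using (ℕ)
open import Data.Product using (∃-syntax; _,_)
open import Data.Sum using (_⊎_; inj₁; inj₂)
open import Data.Empty using (⊥-elim)
open import Relation.Nullary using (¬_)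
open import Relation.Binary.PropositionalEquality using (_≡_; refl)
open import Relation.Binary.Construct.Closure.ReflexiveTransitive using (ε; _◅_)

data Stuck {n : ℕ} : Comp n → Set where
  var-head : ∀ j L → Stuck (app (var j) L)
  lam-head : ∀ P {S} → Stuck S → Stuck (app (lam P) S)

¬Stuck-ret : ∀ {n} {W : Val n} → ¬ Stuck (ret W)
¬Stuck-ret ()

Stuck-→© : ∀ {n} {M M' : Comp n} → Stuck M → M →© M' → Stuck M'
Stuck-→© (var-head j L) (root (by-βc ()))
Stuck-→© (var-head j L) (root (by-id ()))
Stuck-→© (var-head j L) (root (by-σ ()))
Stuck-→© (var-head j L) (app-r _ _)                           = var-head j _
Stuck-→© (lam-head P ()) (root (by-βc (βc _ _)))
Stuck-→© (lam-head P s) (root (by-id (idr _)))                = s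
Stuck-→© (lam-head P (lam-head Q s)) (root (by-σ (σr _ _ _))) = lam-head _ s
Stuck-→© (lam-head P s) (app-r _ r)                           = lam-head P (Stuck-→© s r)
Stuck-→© (lam-head P s) (app-lam _ _)                         = lam-head _ s

Stuck-→©* : ∀ {n} {M M' : Comp n} → Stuck M → M →©* M' → Stuck M'
Stuck-→©* s ε        = s
Stuck-→©* s (r ◅ rs) = Stuck-→©* (Stuck-→© s r) rs

mainTheorem14 : ∀ {n : ℕ} (M : Comp n) (W : Val n) → M →©* ret W →
    βc-redex M ⊎ σ-redex M ⊎ (∃[ U ] (M ≡ ret U))
mainTheorem14 (ret U) W _                        = inj₂ (inj₂ (U , refl))
mainTheorem14 (app (lam P) (ret V)) W _          = inj₁ (_ , βc P V)
mainTheorem14 (app (lam P) (app (lam Q) L)) W _  = inj₂ (inj₁ (_ , σr P Q L))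
mainTheorem14 (app (var j) L) W rs               =
  ⊥-elim (¬Stuck-ret (Stuck-→©* (var-head j L) rs))
mainTheorem14 (app (lam P) (app (var j) L)) W rs =
  ⊥-elim (¬Stuck-ret (Stuck-→©* (lam-head P (var-head j L)) rs))
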